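{- For every two elements $u<w$ in the poset of shuffles $W_{MN}$ and every integer $i$ with $0\le i\le\rho(w)-\rho(u)$, there is a bijection between the set of elements of $[u,w]$ of rank $\rho(u)+i$ and the set of elements of $[u,w]$ of rank $\rho(w)-i$.
   Context: Let $\mathcal A=\{a_1,\dots,a_M\}$ (lower alphabet) and $\mathcal X=\{x_1,\dots,x_N\}$ (upper alphabet) be disjoint sets. A shuffle word is a (possibly empty) word with distinct letters from $\mathcal A\cup\mathcal X$ such that the letters from $\mathcal A$ in it appear in increasing order of subscripts, and likewise those from $\mathcal X$. The poset of shuffles $W_{MN}$ is the set of shuffle words ordered by the reflexive-transitive closure of the covering relation $w\lessdot w'$ iff $w'$ is obtained from $w$ by deleting one letter of $\mathcal A$ or inserting one letter of $\mathcal X$ (the result being a shuffle word). Its rank function is $\rho(w)=(M-\#(\text{letters of }\mathcal A\text{ in }w))+\#(\text{letters of }\mathcal X\text{ in }w)$. -}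

module Defs where

open import Data.Nat using (ℕ; _+_; _∸_)
open import Data.Fin using (Fin) renaming (_<_ to _<ᶠ_)
open import Data.List using (List; []; _∷_; _++_; length)
open import Data.List.Relation.Unary.Unique.Propositional using (Unique)
open import Data.List.Relation.Unary.Linked using (Linked)
open import Data.Product using (_×_)
open import Relation.Binary.PropositionalEquality using (_≡_; _≢_)
open import Relation.Binary.Construct.Closure.ReflexiveTransitive using (Star)

-- Letters: a i (lower alphabet 𝒜 = {a_1..a_M}) or x j (upper alphabet 𝒳 = {x_1..x_N}),
-- subscripts 0-based via Fin.
data Letter (M N : ℕ) : Set where
  a : Fin M → Letter M N
  x : Fin N → Letter M N

module _ {M N : ℕ} where

  aIdx : List (Letter M N) → List (Fin M)
  aIdx []          = []
  aIdx (a i ∷ w)   = i ∷ aIdx w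
  aIdx (x j ∷ w)   = aIdx w

  xIdx : List (Letter M N) → List (Fin N)
  xIdx []          = []
  xIdx (a i ∷ w)   = xIdx w
  xIdx (x j ∷ w)   = j ∷ xIdx w

  IsShuffle : List (Letter M N) → Set
  IsShuffle w = Unique w × Linked _<ᶠ_ (aIdx w) × Linked _<ᶠ_ (xIdx w)

-- Elements of W_MN: the shuffle-word property is irrelevant, so an element is determined
-- by its word.
record ShuffleWord (M N : ℕ) : Set where
  constructor sw
  field
    word        : List (Letter M N)
    .isShuffle  : IsShuffle word
open ShuffleWord public

module _ {M N : ℕ} where

  data _⋖_ (v w : ShuffleWord M N) : Set where
    delete-a : (p : List (Letter M N)) (i : Fin M) (s : List (Letter M N)) →
               word v ≡ p ++ (a i ∷ s) → word w ≡ p ++ s → v ⋖ w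
    insert-x : (p : List (Letter M N)) (j : Fin N) (s : List (Letter M N)) →
               word v ≡ p ++ s → word w ≡ p ++ (x j ∷ s) → v ⋖ w

  _≤ʷ_ : ShuffleWord M N → ShuffleWord M N → Set
  _≤ʷ_ = Star _⋖_

  _<ʷ_ : ShuffleWord M N → ShuffleWord M N → Set
  u <ʷ w = u ≤ʷ w × u ≢ w

ρ : {M N : ℕ} → ShuffleWord M N → ℕ
ρ {M} w = (M ∸ length (aIdx (word w))) + length (xIdx (word w))

-- the elements of the interval [u,w] of rank k.  Membership proofs are irrelevant,
-- so an element is determined by its shuffle word (this is a set, not a set of paths).
record RankLevel {M N : ℕ} (u w : ShuffleWord M N) (k : ℕ) : Set where
  constructor elt
  field
    elem      : ShuffleWord M N
    .lower    : u ≤ʷ elem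
    .upper    : elem ≤ʷ w
    .hasRank  : ρ elem ≡ k

module Submission where

-- Write u ⊑ v when v arises from u by deleting a-letters and inserting x-letters; this is the
-- order of W_MN.  For u ⊑ v ⊑ w, the letters of u missing from w are a-letters, each kept or
-- deleted by v, and the letters of w missing from u are x-letters, each present in v or not.
-- Swapping these choices sends ρ v to ρ u + ρ w − ρ v.  The choices do not determine the
-- interleaving of v, so the swap is performed on a normal form of the pair of alignments, in
-- which an inserted x directly followed by a kept a is a single crossing step left fixed.  The
-- normal form is unique, so the swap is a function of the words and an involution.

open import Defs
open import Data.Nat using (ℕ; suc; _+_; _∸_; _≤_; _<_; s≤s; z≤n)
open import Data.Nat.Properties
open import Data.Nat.Solver using (module +-*-Solver)
open import Data.Fin using (Fin; toℕ) renaming (_<_ to _<ᶠ_)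
import Data.Fin.Properties as Fin
open import Data.List using (List; []; _∷_; _++_; [_]; length)
open import Data.List.Properties using (++-assoc; ≡-dec)
open import Data.List.Membership.Propositional using (_∈_)
open import Data.List.Relation.Unary.Any using (here; there)
open import Data.List.Relation.Unary.All using (All; []; _∷_)
open import Data.List.Relation.Unary.All.Properties using (All¬⇒¬Any)
open import Data.List.Relation.Unary.AllPairs using (AllPairs; []; _∷_; tail)
open import Data.List.Relation.Unary.Linked using (Linked; []; [-]; _∷_)
open import Data.List.Relation.Unary.Linked.Properties using (AllPairs⇒Linked; Linked⇒AllPairs)
open import Data.List.Relation.Unary.Unique.Propositional using (Unique)
open import Data.List.Relation.Binary.Sublist.Propositional using (_⊆_; []; _∷_; _∷ʳ_; ⊆-refl)
open import Data.List.Relation.Binary.Sublist.Propositional.Properties using (All-resp-⊆; ++⁺)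
open import Data.Product using (_,_; proj₁)
open import Data.Sum using (_⊎_; inj₁; inj₂; [_,_]′)
import Data.Sum as Sum
open import Data.Empty using (⊥-elim)
open import Function.Base using (_∘_)
open import Function.Bundles using (_⤖_; mk↔ₛ′)
open import Function.Properties.Inverse using (↔⇒⤖)
open import Relation.Nullary using (¬_; Dec; yes; no)
open import Relation.Nullary.Decidable using (map′; recompute; _⊎-dec_)
open import Relation.Binary.PropositionalEquality hiding ([_])
open import Relation.Binary.Construct.Closure.ReflexiveTransitive using (ε; _◅_; _◅◅_)

AllPairs-resp-⊇ : ∀ {A : Set} {R : A → A → Set} {xs ys : List A} →
                  xs ⊆ ys → AllPairs R ys → AllPairs R xs
AllPairs-resp-⊇ []         []         = []
AllPairs-resp-⊇ (_ ∷ʳ p)   (_ ∷ rys)  = AllPairs-resp-⊇ p rys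
AllPairs-resp-⊇ (refl ∷ p) (ry ∷ rys) = All-resp-⊆ p ry ∷ AllPairs-resp-⊇ p rys

module _ {n : ℕ} where

  Linked<-resp-⊇ : ∀ {xs ys : List (Fin n)} → xs ⊆ ys → Linked _<ᶠ_ ys → Linked _<ᶠ_ xs
  Linked<-resp-⊇ p = AllPairs⇒Linked ∘ AllPairs-resp-⊇ p ∘ Linked⇒AllPairs Fin.<-trans

  Linked<⇒length+head< : ∀ {y ys} → Linked _<ᶠ_ (y ∷ ys) → length ys + toℕ y < n
  Linked<⇒length+head< {y} [-] = Fin.toℕ<n y
  Linked<⇒length+head< {y} {z ∷ zs} (y<z ∷ z∷zs) = begin-strict
    suc (length zs) + toℕ y ≡⟨ +-suc (length zs) (toℕ y) ⟨
    length zs + suc (toℕ y) ≤⟨ +-monoʳ-≤ (length zs) y<z ⟩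
    length zs + toℕ z       <⟨ Linked<⇒length+head< z∷zs ⟩
    n                       ∎
    where open ≤-Reasoning

  Linked<⇒length≤ : ∀ {ys : List (Fin n)} → Linked _<ᶠ_ ys → length ys ≤ n
  Linked<⇒length≤ []            = z≤n
  Linked<⇒length≤ {y ∷ ys} y∷ys = ≤-trans (s≤s (m≤m+n (length ys) (toℕ y))) (Linked<⇒length+head< y∷ys)

∸-balance : ∀ m {a₁ a₂ a₃ a₄ x₁ x₂ x₃ x₄} → a₁ ≤ m → a₂ ≤ m → a₃ ≤ m → a₄ ≤ m →
            a₁ + a₂ + x₃ + x₄ ≡ a₃ + a₄ + x₁ + x₂ →
            (m ∸ a₁ + x₁) + (m ∸ a₂ + x₂) ≡ (m ∸ a₃ + x₃) + (m ∸ a₄ + x₄)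
∸-balance m {a₁} {a₂} {a₃} {a₄} {x₁} {x₂} {x₃} {x₄} a₁≤m a₂≤m a₃≤m a₄≤m e =
  +-cancelʳ-≡ (a₁ + a₂ + x₃ + x₄) _ _ (begin
    (m ∸ a₁ + x₁) + (m ∸ a₂ + x₂) + (a₁ + a₂ + x₃ + x₄)   ≡⟨ regroup (m ∸ a₁) (m ∸ a₂) a₁ a₂ x₁ x₂ x₃ x₄ ⟩
    (m ∸ a₁ + a₁) + (m ∸ a₂ + a₂) + (x₁ + x₂ + x₃ + x₄)   ≡⟨ cong₂ (λ p q → p + q + _) (m∸n+n≡m a₁≤m) (m∸n+n≡m a₂≤m) ⟩
    m + m + (x₁ + x₂ + x₃ + x₄)                           ≡⟨ cong₂ (λ p q → p + q + _) (m∸n+n≡m a₃≤m) (m∸n+n≡m a₄≤m) ⟨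
    (m ∸ a₃ + a₃) + (m ∸ a₄ + a₄) + (x₁ + x₂ + x₃ + x₄)   ≡⟨ regroup′ (m ∸ a₃) (m ∸ a₄) a₃ a₄ x₁ x₂ x₃ x₄ ⟩
    (m ∸ a₃ + x₃) + (m ∸ a₄ + x₄) + (a₃ + a₄ + x₁ + x₂)   ≡⟨ cong ((m ∸ a₃ + x₃) + (m ∸ a₄ + x₄) +_) e ⟨
    (m ∸ a₃ + x₃) + (m ∸ a₄ + x₄) + (a₁ + a₂ + x₃ + x₄)   ∎)
  where
  open ≡-Reasoning
  open +-*-Solver
  regroup : ∀ d₁ d₂ a₁ a₂ x₁ x₂ x₃ x₄ →
            (d₁ + x₁) + (d₂ + x₂) + (a₁ + a₂ + x₃ + x₄) ≡ (d₁ + a₁) + (d₂ + a₂) + (x₁ + x₂ + x₃ + x₄)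
  regroup = solve 8 (λ d₁ d₂ a₁ a₂ x₁ x₂ x₃ x₄ →
    (d₁ :+ x₁) :+ (d₂ :+ x₂) :+ (a₁ :+ a₂ :+ x₃ :+ x₄) := (d₁ :+ a₁) :+ (d₂ :+ a₂) :+ (x₁ :+ x₂ :+ x₃ :+ x₄)) refl
  regroup′ : ∀ d₃ d₄ a₃ a₄ x₁ x₂ x₃ x₄ →
             (d₃ + a₃) + (d₄ + a₄) + (x₁ + x₂ + x₃ + x₄) ≡ (d₃ + x₃) + (d₄ + x₄) + (a₃ + a₄ + x₁ + x₂)
  regroup′ = solve 8 (λ d₃ d₄ a₃ a₄ x₁ x₂ x₃ x₄ →
    (d₃ :+ a₃) :+ (d₄ :+ a₄) :+ (x₁ :+ x₂ :+ x₃ :+ x₄) := (d₃ :+ x₃) :+ (d₄ :+ x₄) :+ (a₃ :+ a₄ :+ x₁ :+ x₂)) refl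

module _ {M N : ℕ} where
  private
    L = Letter M N

  _≟ˡ_ : (c d : L) → Dec (c ≡ d)
  a i ≟ˡ a k with i Fin.≟ k
  ... | yes refl = yes refl
  ... | no i≢k   = no λ { refl → i≢k refl }
  x j ≟ˡ x k with j Fin.≟ k
  ... | yes refl = yes refl
  ... | no j≢k   = no λ { refl → j≢k refl }
  a _ ≟ˡ x _ = no λ ()
  x _ ≟ˡ a _ = no λ ()

  aIdx-mono : ∀ {vs ws : List L} → vs ⊆ ws → aIdx vs ⊆ aIdx ws
  aIdx-mono []                    = []
  aIdx-mono (a i ∷ʳ p)            = i ∷ʳ aIdx-mono p
  aIdx-mono (x _ ∷ʳ p)            = aIdx-mono p
  aIdx-mono {a _ ∷ _} (refl ∷ p)  = refl ∷ aIdx-mono p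
  aIdx-mono {x _ ∷ _} (refl ∷ p)  = aIdx-mono p

  xIdx-mono : ∀ {vs ws : List L} → vs ⊆ ws → xIdx vs ⊆ xIdx ws
  xIdx-mono []                    = []
  xIdx-mono (a _ ∷ʳ p)            = xIdx-mono p
  xIdx-mono (x j ∷ʳ p)            = j ∷ʳ xIdx-mono p
  xIdx-mono {a _ ∷ _} (refl ∷ p)  = xIdx-mono p
  xIdx-mono {x _ ∷ _} (refl ∷ p)  = refl ∷ xIdx-mono p

  IsShuffle-resp-⊇ : ∀ {vs ws : List L} → vs ⊆ ws → IsShuffle ws → IsShuffle vs
  IsShuffle-resp-⊇ p (distinct , as , xs) =
    AllPairs-resp-⊇ p distinct , Linked<-resp-⊇ (aIdx-mono p) as , Linked<-resp-⊇ (xIdx-mono p) xs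

  a-fresh : ∀ {i} (w : List L) → All (i <ᶠ_) (aIdx w) → All (a i ≢_) w
  a-fresh []        []          = []
  a-fresh (a _ ∷ w) (i<k ∷ i<w) = (λ { refl → Fin.<-irrefl refl i<k }) ∷ a-fresh w i<w
  a-fresh (x _ ∷ w) i<w         = (λ ()) ∷ a-fresh w i<w

  x-fresh : ∀ {j} (w : List L) → All (j <ᶠ_) (xIdx w) → All (x j ≢_) w
  x-fresh []        []          = []
  x-fresh (a _ ∷ w) j<w         = (λ ()) ∷ x-fresh w j<w
  x-fresh (x _ ∷ w) (j<k ∷ j<w) = (λ { refl → Fin.<-irrefl refl j<k }) ∷ x-fresh w j<w

  sorted⇒Unique : ∀ (w : List L) → AllPairs _<ᶠ_ (aIdx w) → AllPairs _<ᶠ_ (xIdx w) → Unique w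
  sorted⇒Unique []        _           _           = []
  sorted⇒Unique (a _ ∷ w) (i<w ∷ as)  xs          = a-fresh w i<w ∷ sorted⇒Unique w as xs
  sorted⇒Unique (x _ ∷ w) as          (j<w ∷ xs)  = x-fresh w j<w ∷ sorted⇒Unique w as xs

  sorted⇒IsShuffle : ∀ (w : List L) → Linked _<ᶠ_ (aIdx w) → Linked _<ᶠ_ (xIdx w) → IsShuffle w
  sorted⇒IsShuffle w as xs =
    sorted⇒Unique w (Linked⇒AllPairs Fin.<-trans as) (Linked⇒AllPairs Fin.<-trans xs) , as , xs

  aIdx-length≤ : ∀ {w : List L} → IsShuffle w → length (aIdx w) ≤ M
  aIdx-length≤ (_ , as , _) = Linked<⇒length≤ as

  infix 4 _⊑_
  data _⊑_ : List L → List L → Set where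
    []   : [] ⊑ []
    keep : ∀ c {u v} → u ⊑ v → c ∷ u ⊑ c ∷ v
    del  : ∀ i {u v} → u ⊑ v → a i ∷ u ⊑ v
    ins  : ∀ j {u v} → u ⊑ v → u ⊑ x j ∷ v

  ⊑-refl : ∀ {u} → u ⊑ u
  ⊑-refl {[]}    = []
  ⊑-refl {c ∷ u} = keep c ⊑-refl

  ⊑-trans : ∀ {u v w} → u ⊑ v → v ⊑ w → u ⊑ w
  ⊑-trans (del i p)  q          = del i (⊑-trans p q)
  ⊑-trans p          (ins j q)  = ins j (⊑-trans p q)
  ⊑-trans []         []         = []
  ⊑-trans (keep c p) (keep c q) = keep c (⊑-trans p q)
  ⊑-trans (keep c p) (del i q)  = del i (⊑-trans p q)
  ⊑-trans (ins j p)  (keep c q) = ins j (⊑-trans p q)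

  ++⁺-⊑ : ∀ pre {u v} → u ⊑ v → pre ++ u ⊑ pre ++ v
  ++⁺-⊑ []        p = p
  ++⁺-⊑ (c ∷ pre) p = keep c (++⁺-⊑ pre p)

  ⋖⇒⊑ : ∀ {v w : ShuffleWord M N} → v ⋖ w → word v ⊑ word w
  ⋖⇒⊑ {sw _ _} {sw _ _} (delete-a pre i s refl refl) = ++⁺-⊑ pre (del i ⊑-refl)
  ⋖⇒⊑ {sw _ _} {sw _ _} (insert-x pre j s refl refl) = ++⁺-⊑ pre (ins j ⊑-refl)

  ≤ʷ⇒⊑ : ∀ {v w : ShuffleWord M N} → v ≤ʷ w → word v ⊑ word w
  ≤ʷ⇒⊑ ε       = ⊑-refl
  ≤ʷ⇒⊑ (c ◅ r) = ⊑-trans (⋖⇒⊑ c) (≤ʷ⇒⊑ r)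

  sw-cong : ∀ {v w : List L} .{hv : IsShuffle v} .{hw : IsShuffle w} → v ≡ w → sw v hv ≡ sw w hw
  sw-cong refl = refl

  ⊑⇒≤ʷ-after : ∀ pre {s t} → s ⊑ t → .(hs : IsShuffle (pre ++ s)) .(ht : IsShuffle (pre ++ t)) →
               sw (pre ++ s) hs ≤ʷ sw (pre ++ t) ht
  ⊑⇒≤ʷ-after pre [] hs ht = ε
  ⊑⇒≤ʷ-after pre {c ∷ s} {c ∷ t} (keep c p) hs ht =
    subst₂ _≤ʷ_ (sw-cong (++-assoc pre [ c ] s)) (sw-cong (++-assoc pre [ c ] t))
      (⊑⇒≤ʷ-after (pre ++ [ c ]) p (subst IsShuffle (sym (++-assoc pre [ c ] s)) hs)
                                   (subst IsShuffle (sym (++-assoc pre [ c ] t)) ht))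
  ⊑⇒≤ʷ-after pre (del i {s} p) hs ht =
    delete-a pre i s refl refl ◅ ⊑⇒≤ʷ-after pre p (IsShuffle-resp-⊇ (++⁺ ⊆-refl (a i ∷ʳ ⊆-refl)) hs) ht
  ⊑⇒≤ʷ-after pre (ins j {v = t} p) hs ht =
    ⊑⇒≤ʷ-after pre p hs (IsShuffle-resp-⊇ (++⁺ ⊆-refl (x j ∷ʳ ⊆-refl)) ht) ◅◅ (insert-x pre j t refl refl ◅ ε)

  ⊑⇒≤ʷ : ∀ {v w : ShuffleWord M N} → word v ⊑ word w → v ≤ʷ w
  ⊑⇒≤ʷ {sw _ hv} {sw _ hw} p = ⊑⇒≤ʷ-after [] p hv hw

  ⊑⇒aIdx-⊇ : ∀ {u v} → u ⊑ v → aIdx v ⊆ aIdx u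
  ⊑⇒aIdx-⊇ []             = []
  ⊑⇒aIdx-⊇ (keep (a i) p) = refl ∷ ⊑⇒aIdx-⊇ p
  ⊑⇒aIdx-⊇ (keep (x j) p) = ⊑⇒aIdx-⊇ p
  ⊑⇒aIdx-⊇ (del i p)      = i ∷ʳ ⊑⇒aIdx-⊇ p
  ⊑⇒aIdx-⊇ (ins j p)      = ⊑⇒aIdx-⊇ p

  ⊑⇒xIdx-⊆ : ∀ {u v} → u ⊑ v → xIdx u ⊆ xIdx v
  ⊑⇒xIdx-⊆ []             = []
  ⊑⇒xIdx-⊆ (keep (a i) p) = ⊑⇒xIdx-⊆ p
  ⊑⇒xIdx-⊆ (keep (x j) p) = refl ∷ ⊑⇒xIdx-⊆ p
  ⊑⇒xIdx-⊆ (del i p)      = ⊑⇒xIdx-⊆ p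
  ⊑⇒xIdx-⊆ (ins j p)      = j ∷ʳ ⊑⇒xIdx-⊆ p

  ⊑-between-IsShuffle : ∀ {u v w} → u ⊑ v → v ⊑ w → IsShuffle u → IsShuffle w → IsShuffle v
  ⊑-between-IsShuffle {v = v} p q (_ , as , _) (_ , _ , xs) =
    sorted⇒IsShuffle v (Linked<-resp-⊇ (⊑⇒aIdx-⊇ p) as) (Linked<-resp-⊇ (⊑⇒xIdx-⊆ q) xs)

  ⊑-a∈ : ∀ {u v i} → u ⊑ v → a i ∈ v → a i ∈ u
  ⊑-a∈ (keep c p) (here e)  = here e
  ⊑-a∈ (keep c p) (there m) = there (⊑-a∈ p m)
  ⊑-a∈ (del i p)  m         = there (⊑-a∈ p m)
  ⊑-a∈ (ins j p)  (there m) = ⊑-a∈ p m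

  ⊑-x∈ : ∀ {u v j} → u ⊑ v → x j ∈ u → x j ∈ v
  ⊑-x∈ (keep c p) (here e)  = here e
  ⊑-x∈ (keep c p) (there m) = there (⊑-x∈ p m)
  ⊑-x∈ (del i p)  (there m) = ⊑-x∈ p m
  ⊑-x∈ (ins j p)  m         = there (⊑-x∈ p m)

  a-step? : ∀ i k {u v} → Dec (u ⊑ v) → Dec (u ⊑ a k ∷ v) → Dec (a i ∷ u ⊑ a k ∷ v)
  a-step? i k u⊑v? u⊑akv? with i Fin.≟ k
  ... | yes refl = map′ [ keep (a i) , del i ]′ (λ { (keep _ p) → inj₁ p ; (del _ p) → inj₂ p })
                        (u⊑v? ⊎-dec u⊑akv?)
  ... | no i≢k   = map′ (del i) (λ { (keep _ _) → ⊥-elim (i≢k refl) ; (del _ p) → p }) u⊑akv?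

  x-step? : ∀ j k {u v} → Dec (u ⊑ v) → Dec (x j ∷ u ⊑ v) → Dec (x j ∷ u ⊑ x k ∷ v)
  x-step? j k u⊑v? xju⊑v? with j Fin.≟ k
  ... | yes refl = map′ [ keep (x j) , ins j ]′ (λ { (keep _ p) → inj₁ p ; (ins _ p) → inj₂ p })
                        (u⊑v? ⊎-dec xju⊑v?)
  ... | no j≢k   = map′ (ins k) (λ { (keep _ _) → ⊥-elim (j≢k refl) ; (ins _ p) → p }) xju⊑v?

  _⊑?_ : (u v : List L) → Dec (u ⊑ v)
  []        ⊑? []        = yes []
  []        ⊑? (a _ ∷ _) = no λ ()
  []        ⊑? (x j ∷ v) = map′ (ins j) (λ { (ins _ p) → p }) ([] ⊑? v)
  (a i ∷ u) ⊑? []        = map′ (del i) (λ { (del _ p) → p }) (u ⊑? [])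
  (x _ ∷ _) ⊑? []        = no λ ()
  (x _ ∷ _) ⊑? (a _ ∷ _) = no λ ()
  (a i ∷ u) ⊑? (x j ∷ v) =
    map′ [ del i , ins j ]′ (λ { (del _ p) → inj₁ p ; (ins _ p) → inj₂ p })
         ((u ⊑? (x j ∷ v)) ⊎-dec ((a i ∷ u) ⊑? v))
  (a i ∷ u) ⊑? (a k ∷ v) = a-step? i k (u ⊑? v) (u ⊑? (a k ∷ v))
  (x j ∷ u) ⊑? (x k ∷ v) = x-step? j k (u ⊑? v) ((x j ∷ u) ⊑? v)

  data Phase : Set where
    free afterX : Phase

  -- Between shared letters the a-steps come first: an a-step may not follow an x-step (phase
  -- afterX), except inside a cross.
  data Normal : Phase → List L → List L → List L → Set where
    []     : ∀ {s} → Normal s [] [] []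
    shared : ∀ {s u v w} c → Normal free u v w → Normal s (c ∷ u) (c ∷ v) (c ∷ w)
    a-in   : ∀ {u v w} i → Normal free u v w → Normal free (a i ∷ u) (a i ∷ v) w
    a-out  : ∀ {u v w} i → Normal free u v w → Normal free (a i ∷ u) v w
    x-in   : ∀ {s u v w} j → Normal afterX u v w → Normal s u (x j ∷ v) (x j ∷ w)
    x-out  : ∀ {s u v w} j → Normal afterX u v w → Normal s u v (x j ∷ w)
    cross  : ∀ {s u v w} i j → Normal free u v w → Normal s (a i ∷ u) (x j ∷ a i ∷ v) (x j ∷ w)

  complement : ∀ {s u v w} → Normal s u v w → List L
  complement []            = []
  complement (shared c d)  = c ∷ complement d
  complement (a-in i d)    = complement d
  complement (a-out i d)   = a i ∷ complement d
  complement (x-in j d)    = complement d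
  complement (x-out j d)   = x j ∷ complement d
  complement (cross i j d) = x j ∷ a i ∷ complement d

  complement-Normal : ∀ {s u v w} (d : Normal s u v w) → Normal s u (complement d) w
  complement-Normal []            = []
  complement-Normal (shared c d)  = shared c (complement-Normal d)
  complement-Normal (a-in i d)    = a-out i (complement-Normal d)
  complement-Normal (a-out i d)   = a-in i (complement-Normal d)
  complement-Normal (x-in j d)    = x-out j (complement-Normal d)
  complement-Normal (x-out j d)   = x-in j (complement-Normal d)
  complement-Normal (cross i j d) = cross i j (complement-Normal d)

  complement-involutive : ∀ {s u v w} (d : Normal s u v w) → complement (complement-Normal d) ≡ v
  complement-involutive []            = refl
  complement-involutive (shared c d)  = cong (c ∷_) (complement-involutive d)
  complement-involutive (a-in i d)    = cong (a i ∷_) (complement-involutive d)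
  complement-involutive (a-out i d)   = complement-involutive d
  complement-involutive (x-in j d)    = cong (x j ∷_) (complement-involutive d)
  complement-involutive (x-out j d)   = complement-involutive d
  complement-involutive (cross i j d) = cong (λ v → x j ∷ a i ∷ v) (complement-involutive d)

  lower : ∀ {s u v w} → Normal s u v w → u ⊑ v
  lower []            = []
  lower (shared c d)  = keep c (lower d)
  lower (a-in i d)    = keep (a i) (lower d)
  lower (a-out i d)   = del i (lower d)
  lower (x-in j d)    = ins j (lower d)
  lower (x-out j d)   = lower d
  lower (cross i j d) = ins j (keep (a i) (lower d))

  upper : ∀ {s u v w} → Normal s u v w → v ⊑ w
  upper []            = []
  upper (shared c d)  = keep c (upper d)
  upper (a-in i d)    = del i (upper d)
  upper (a-out i d)   = upper d
  upper (x-in j d)    = keep (x j) (upper d)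
  upper (x-out j d)   = ins j (upper d)
  upper (cross i j d) = keep (x j) (del i (upper d))

  x-in′ : ∀ {u v w} j → Normal free u v w → Normal free u (x j ∷ v) (x j ∷ w)
  x-in′ j []            = x-in j []
  x-in′ j (shared c d)  = x-in j (shared c d)
  x-in′ j (a-in i d)    = cross i j d
  x-in′ j (a-out i d)   = a-out i (x-in′ j d)
  x-in′ j (x-in k d)    = x-in j (x-in k d)
  x-in′ j (x-out k d)   = x-in j (x-out k d)
  x-in′ j (cross i k d) = x-in j (cross i k d)

  x-out′ : ∀ {u v w} j → Normal free u v w → Normal free u v (x j ∷ w)
  x-out′ j []            = x-out j []
  x-out′ j (shared c d)  = x-out j (shared c d)
  x-out′ j (a-in i d)    = a-in i (x-out′ j d)
  x-out′ j (a-out i d)   = a-out i (x-out′ j d)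
  x-out′ j (x-in k d)    = x-out j (x-in k d)
  x-out′ j (x-out k d)   = x-out j (x-out k d)
  x-out′ j (cross i k d) = x-out j (cross i k d)

  normalise : ∀ {u v w} → u ⊑ v → v ⊑ w → Normal free u v w
  normalise (del i p)  q          = a-out i (normalise p q)
  normalise p          (ins j q)  = x-out′ j (normalise p q)
  normalise []         []         = []
  normalise (keep c p) (keep c q) = shared c (normalise p q)
  normalise (keep c p) (del i q)  = a-in i (normalise p q)
  normalise (ins j p)  (keep c q) = x-in′ j (normalise p q)

  outer : ∀ {s u v w} → Normal s u v w → u ⊑ w
  outer d = ⊑-trans (lower d) (upper d)

  afterX-a-in⇒∈ʷ : ∀ {i u v w} → Normal afterX (a i ∷ u) (a i ∷ v) w → a i ∈ w
  afterX-a-in⇒∈ʷ (shared _ d) = here refl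
  afterX-a-in⇒∈ʷ (x-out j d)  = there (afterX-a-in⇒∈ʷ d)

  afterX-a∈ᵛ⊎∈ʷ : ∀ {i u v w} → Normal afterX (a i ∷ u) v w → a i ∈ v ⊎ a i ∈ w
  afterX-a∈ᵛ⊎∈ʷ (shared _ d)  = inj₂ (here refl)
  afterX-a∈ᵛ⊎∈ʷ (x-in j d)    = Sum.map there there (afterX-a∈ᵛ⊎∈ʷ d)
  afterX-a∈ᵛ⊎∈ʷ (x-out j d)   = Sum.map₂ there (afterX-a∈ᵛ⊎∈ʷ d)
  afterX-a∈ᵛ⊎∈ʷ (cross i j d) = inj₁ (there (here refl))

  head∉tail : ∀ {c} {u : List L} → Unique (c ∷ u) → ¬ c ∈ u
  head∉tail (c∉u ∷ _) = All¬⇒¬Any c∉u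

  Normal-unique : ∀ {s u v w} → Unique u → Unique w → (d e : Normal s u v w) → d ≡ e
  Normal-unique uu uw [] [] = refl
  Normal-unique uu uw (shared c d)  (shared c e)  = cong (shared c) (Normal-unique (tail uu) (tail uw) d e)
  Normal-unique uu uw (a-in i d)    (a-in i e)    = cong (a-in i) (Normal-unique (tail uu) uw d e)
  Normal-unique uu uw (a-out i d)   (a-out i e)   = cong (a-out i) (Normal-unique (tail uu) uw d e)
  Normal-unique uu uw (x-in j d)    (x-in j e)    = cong (x-in j) (Normal-unique uu (tail uw) d e)
  Normal-unique uu uw (x-out j d)   (x-out j e)   = cong (x-out j) (Normal-unique uu (tail uw) d e)
  Normal-unique uu uw (cross i j d) (cross i j e) = cong (cross i j) (Normal-unique (tail uu) (tail uw) d e)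
  Normal-unique uu uw (shared _ d)  (a-in i e)    = ⊥-elim (head∉tail uu (⊑-a∈ (outer e) (here refl)))
  Normal-unique uu uw (shared _ d)  (a-out i e)   = ⊥-elim (head∉tail uu (⊑-a∈ (outer e) (here refl)))
  Normal-unique uu uw (shared _ d)  (x-in j e)    = ⊥-elim (head∉tail uw (⊑-x∈ (outer e) (here refl)))
  Normal-unique uu uw (shared _ d)  (x-out j e)   = ⊥-elim (head∉tail uw (⊑-x∈ (outer e) (here refl)))
  Normal-unique uu uw (a-in i d)    (shared _ e)  = ⊥-elim (head∉tail uu (⊑-a∈ (outer d) (here refl)))
  Normal-unique uu uw (a-in i d)    (a-out i e)   = ⊥-elim (head∉tail uu (⊑-a∈ (lower e) (here refl)))
  Normal-unique uu uw (a-in i d)    (x-out j e)   =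
    ⊥-elim (head∉tail uu (⊑-a∈ (outer d) (there (afterX-a-in⇒∈ʷ e))))
  Normal-unique uu uw (a-out i d)   (shared _ e)  = ⊥-elim (head∉tail uu (⊑-a∈ (outer d) (here refl)))
  Normal-unique uu uw (a-out i d)   (a-in i e)    = ⊥-elim (head∉tail uu (⊑-a∈ (lower d) (here refl)))
  Normal-unique uu uw (a-out i d)   (x-in j e)    =
    ⊥-elim (head∉tail uu ([ ⊑-a∈ (lower d) ∘ there , ⊑-a∈ (outer d) ∘ there ]′ (afterX-a∈ᵛ⊎∈ʷ e)))
  Normal-unique uu uw (a-out i d)   (x-out j e)   =
    ⊥-elim (head∉tail uu ([ ⊑-a∈ (lower d) , ⊑-a∈ (outer d) ∘ there ]′ (afterX-a∈ᵛ⊎∈ʷ e)))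
  Normal-unique uu uw (a-out i d)   (cross i j e) = ⊥-elim (head∉tail uu (⊑-a∈ (lower d) (there (here refl))))
  Normal-unique uu uw (x-in j d)    (shared _ e)  = ⊥-elim (head∉tail uw (⊑-x∈ (outer d) (here refl)))
  Normal-unique uu uw (x-in j d)    (a-out i e)   =
    ⊥-elim (head∉tail uu ([ ⊑-a∈ (lower e) ∘ there , ⊑-a∈ (outer e) ∘ there ]′ (afterX-a∈ᵛ⊎∈ʷ d)))
  Normal-unique uu uw (x-in j d)    (x-out j e)   = ⊥-elim (head∉tail uw (⊑-x∈ (upper e) (here refl)))
  Normal-unique uu uw (x-in j d)    (cross i j e) = ⊥-elim (head∉tail uu (⊑-a∈ (outer e) (afterX-a-in⇒∈ʷ d)))
  Normal-unique uu uw (x-out j d)   (shared _ e)  = ⊥-elim (head∉tail uw (⊑-x∈ (outer d) (here refl)))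
  Normal-unique uu uw (x-out j d)   (a-in i e)    =
    ⊥-elim (head∉tail uu (⊑-a∈ (outer e) (there (afterX-a-in⇒∈ʷ d))))
  Normal-unique uu uw (x-out j d)   (a-out i e)   =
    ⊥-elim (head∉tail uu ([ ⊑-a∈ (lower e) , ⊑-a∈ (outer e) ∘ there ]′ (afterX-a∈ᵛ⊎∈ʷ d)))
  Normal-unique uu uw (x-out j d)   (x-in j e)    = ⊥-elim (head∉tail uw (⊑-x∈ (upper d) (here refl)))
  Normal-unique uu uw (x-out j d)   (cross i j e) = ⊥-elim (head∉tail uw (⊑-x∈ (upper d) (here refl)))
  Normal-unique uu uw (cross i j d) (a-out i e)   = ⊥-elim (head∉tail uu (⊑-a∈ (lower e) (there (here refl))))
  Normal-unique uu uw (cross i j d) (x-in j e)    = ⊥-elim (head∉tail uu (⊑-a∈ (outer d) (afterX-a-in⇒∈ʷ e)))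
  Normal-unique uu uw (cross i j d) (x-out j e)   = ⊥-elim (head∉tail uw (⊑-x∈ (upper e) (here refl)))

  #a #x : List L → ℕ
  #a w = length (aIdx w)
  #x w = length (xIdx w)

  Balanced : List L → List L → List L → List L → Set
  Balanced u v v′ w = #a v + #a v′ + #x u + #x w ≡ #a u + #a w + #x v + #x v′

  balance-step : ∀ k₁ k₂ k₃ k₄ l₁ l₂ l₃ l₄ → k₁ + k₂ + k₃ + k₄ ≡ l₁ + l₂ + l₃ + l₄ →
                 ∀ {s u v w} (d : Normal s u v w) → let v′ = complement d in Balanced u v v′ w →
                 (k₁ + #a v) + (k₂ + #a v′) + (k₃ + #x u) + (k₄ + #x w) ≡
                 (l₁ + #a u) + (l₂ + #a w) + (l₃ + #x v) + (l₄ + #x v′)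
  balance-step k₁ k₂ k₃ k₄ l₁ l₂ l₃ l₄ k≡l {u = u} {v} {w} d b = begin
    (k₁ + #a v) + (k₂ + #a v′) + (k₃ + #x u) + (k₄ + #x w)      ≡⟨ interchange k₁ k₂ k₃ k₄ (#a v) (#a v′) (#x u) (#x w) ⟩
    (k₁ + k₂ + k₃ + k₄) + (#a v + #a v′ + #x u + #x w)          ≡⟨ cong₂ _+_ k≡l b ⟩
    (l₁ + l₂ + l₃ + l₄) + (#a u + #a w + #x v + #x v′)          ≡⟨ interchange l₁ l₂ l₃ l₄ (#a u) (#a w) (#x v) (#x v′) ⟨
    (l₁ + #a u) + (l₂ + #a w) + (l₃ + #x v) + (l₄ + #x v′)      ∎
    where
    v′ = complement d
    open ≡-Reasoning
    open +-*-Solver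
    interchange : ∀ p₁ p₂ p₃ p₄ q₁ q₂ q₃ q₄ →
                  (p₁ + q₁) + (p₂ + q₂) + (p₃ + q₃) + (p₄ + q₄) ≡ (p₁ + p₂ + p₃ + p₄) + (q₁ + q₂ + q₃ + q₄)
    interchange = solve 8 (λ p₁ p₂ p₃ p₄ q₁ q₂ q₃ q₄ →
      (p₁ :+ q₁) :+ (p₂ :+ q₂) :+ (p₃ :+ q₃) :+ (p₄ :+ q₄) := (p₁ :+ p₂ :+ p₃ :+ p₄) :+ (q₁ :+ q₂ :+ q₃ :+ q₄)) refl

  -- The numerals record what a step adds to #a v, #a v′, #x u, #x w and to #a u, #a w, #x v, #x v′.
  balance : ∀ {s u v w} (d : Normal s u v w) → Balanced u v (complement d) w
  balance []                = refl
  balance (shared (a _) d)  = balance-step 1 1 0 0 1 1 0 0 refl d (balance d)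
  balance (shared (x _) d)  = balance-step 0 0 1 1 0 0 1 1 refl d (balance d)
  balance (a-in i d)        = balance-step 1 0 0 0 1 0 0 0 refl d (balance d)
  balance (a-out i d)       = balance-step 0 1 0 0 1 0 0 0 refl d (balance d)
  balance (x-in j d)        = balance-step 0 0 0 1 0 0 1 0 refl d (balance d)
  balance (x-out j d)       = balance-step 0 0 0 1 0 0 0 1 refl d (balance d)
  balance (cross i j d)     = balance-step 1 1 0 1 1 0 1 1 refl d (balance d)

  ρˡ : List L → ℕ
  ρˡ w = (M ∸ #a w) + #x w

  -- Junk value v when v lies outside [u, w].
  complementIn : List L → List L → List L → List L
  complementIn u w v with u ⊑? v | v ⊑? w
  ... | yes p | yes q = complement (normalise p q)
  ... | _     | _     = v

  complementIn-Normal : ∀ {u v w} → Unique u → Unique w → (d : Normal free u v w) →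
                        complementIn u w v ≡ complement d
  complementIn-Normal {u} {v} {w} uu uw d with u ⊑? v | v ⊑? w
  ... | yes p | yes q = cong complement (Normal-unique uu uw (normalise p q) d)
  ... | no ¬p | _     = ⊥-elim (¬p (lower d))
  ... | yes _ | no ¬q = ⊥-elim (¬q (upper d))

  module _ {u v w : List L} (hu : IsShuffle u) (hw : IsShuffle w) (p : u ⊑ v) (q : v ⊑ w) where
    private
      d : Normal free u v w
      d = normalise p q

      complementIn≡ : complementIn u w v ≡ complement d
      complementIn≡ = complementIn-Normal (proj₁ hu) (proj₁ hw) d

      complement-IsShuffle : IsShuffle (complement d)
      complement-IsShuffle = ⊑-between-IsShuffle (lower (complement-Normal d)) (upper (complement-Normal d)) hu hw

    complementIn-lower : u ⊑ complementIn u w v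
    complementIn-lower rewrite complementIn≡ = lower (complement-Normal d)

    complementIn-upper : complementIn u w v ⊑ w
    complementIn-upper rewrite complementIn≡ = upper (complement-Normal d)

    complementIn-IsShuffle : IsShuffle (complementIn u w v)
    complementIn-IsShuffle rewrite complementIn≡ = complement-IsShuffle

    complementIn-ρˡ : IsShuffle v → ρˡ v + ρˡ (complementIn u w v) ≡ ρˡ u + ρˡ w
    complementIn-ρˡ hv rewrite complementIn≡ =
      ∸-balance M (aIdx-length≤ hv) (aIdx-length≤ complement-IsShuffle) (aIdx-length≤ hu) (aIdx-length≤ hw) (balance d)

    complementIn-involutive : complementIn u w (complementIn u w v) ≡ v
    complementIn-involutive = begin
      complementIn u w (complementIn u w v) ≡⟨ cong (complementIn u w) complementIn≡ ⟩
      complementIn u w (complement d)       ≡⟨ complementIn-Normal (proj₁ hu) (proj₁ hw) (complement-Normal d) ⟩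
      complement (complement-Normal d)      ≡⟨ complement-involutive d ⟩
      v                                     ∎
      where open ≡-Reasoning

RankLevel-≡ : ∀ {M N} {u w : ShuffleWord M N} {k} {r₁ r₂ : RankLevel u w k} →
              word (RankLevel.elem r₁) ≡ word (RankLevel.elem r₂) → r₁ ≡ r₂
RankLevel-≡ {r₁ = elt (sw _ _) _ _ _} {elt (sw _ _) _ _ _} refl = refl

complementˡ : ∀ {M N} {u w : ShuffleWord M N} {k l} → k + l ≡ ρ u + ρ w → RankLevel u w k → RankLevel u w l
complementˡ {u = sw U hu} {sw W hw} {k} k+l≡ (elt (sw V hv) u≤v v≤w ρv≡k) =
  elt (sw (complementIn U W V) (complementIn-IsShuffle hu hw p q))
      (⊑⇒≤ʷ (complementIn-lower hu hw p q))
      (⊑⇒≤ʷ (complementIn-upper hu hw p q))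
      (+-cancelˡ-≡ k _ _ (trans (cong (_+ _) (sym ρv≡k)) (trans (complementIn-ρˡ hu hw p q hv) (sym k+l≡))))
  where
  p = recompute (U ⊑? V) (≤ʷ⇒⊑ u≤v)
  q = recompute (V ⊑? W) (≤ʷ⇒⊑ v≤w)

complementˡ-involutive : ∀ {M N} {u w : ShuffleWord M N} {k l} (y : RankLevel u w k)
                         (k+l≡ : k + l ≡ ρ u + ρ w) (l+k≡ : l + k ≡ ρ u + ρ w) →
                         complementˡ l+k≡ (complementˡ k+l≡ y) ≡ y
complementˡ-involutive {u = sw U hu} {sw W hw} (elt (sw V _) u≤v v≤w _) _ _ =
  RankLevel-≡ (recompute (≡-dec _≟ˡ_ _ V) (complementIn-involutive hu hw (≤ʷ⇒⊑ u≤v) (≤ʷ⇒⊑ v≤w)))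

corollary3p7 : (M N : ℕ) (u w : ShuffleWord M N) → u <ʷ w →
               (i : ℕ) → i ≤ ρ w ∸ ρ u →
               RankLevel u w (ρ u + i) ⤖ RankLevel u w (ρ w ∸ i)
corollary3p7 M N u w _ i i≤ρw-ρu =
  ↔⇒⤖ (mk↔ₛ′ (complementˡ e₁) (complementˡ e₂) (λ y → complementˡ-involutive y e₂ e₁) (λ y → complementˡ-involutive y e₁ e₂))
  where
  i≤ρw : i ≤ ρ w
  i≤ρw = ≤-trans i≤ρw-ρu (m∸n≤m (ρ w) (ρ u))
  e₁ : (ρ u + i) + (ρ w ∸ i) ≡ ρ u + ρ w
  e₁ = trans (+-assoc (ρ u) i (ρ w ∸ i)) (cong (ρ u +_) (m+[n∸m]≡n i≤ρw))
  e₂ : (ρ w ∸ i) + (ρ u + i) ≡ ρ u + ρ w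
  e₂ = trans (+-comm (ρ w ∸ i) (ρ u + i)) e₁
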